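{- For any greedoids $\Gamma_1,\Gamma_2$ with disjoint ground sets and any $\Gamma_1$-attachment function $f$, the $\Gamma_2$-attachment $\Gamma_1\sim_f\Gamma_2$ of $\Gamma_1$ is a greedoid.
   Context: A greedoid is a pair $\Gamma=(E,\mathcal F)$ with $E$ finite and $\mathcal F\subseteq 2^E$ (the feasible sets) such that $\emptyset\in\mathcal F$ and for all $F,F'\in\mathcal F$ with $|F'|<|F|$ there is $x\in F-F'$ with $F'\cup\{x\}\in\mathcal F$. The rank is $\rho(A)=\max\{|A'|:A'\subseteq A,A'\in\mathcal F\}$, $\rho(\Gamma)=\rho(E)$. The closure of $A$ is $\sigma(A)=\{e\in E:\rho(A\cup\{e\})=\rho(A)\}$. A $\Gamma$-attachment function is a map $f:\mathcal F\to 2^{[\rho(\Gamma)]}$ such that $|f(F)|=\rho(F)$ for all $F\in\mathcal F$, and $F_1\subseteq\sigma(F_2)$ implies $f(F_1)\subseteq f(F_2)$ for $F_1,F_2\in\mathcal F$. Given $\Gamma_1=(E_0,\mathcal F_1)$, $\Gamma_2$, and a $\Gamma_1$-attachment function $f$, with $\rho=\rho(\Gamma_1)$, the structure $\Gamma_1\sim_f\Gamma_2$ has ground set $E_0\cup E_1\cup\cdots\cup E_\rho$, where $E_1,\dots,E_\rho$ are pairwise disjoint copies of the ground set of $\Gamma_2$ (disjoint from $E_0$); a set $F$ is feasible iff $F\cap E_0\in\mathcal F_1$, each $F\cap E_i$ ($1\le i\le\rho$) corresponds to a feasible set of $\Gamma_2$, and $F\cap E_i=\emptyset$ whenever $i\notin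 f(F\cap E_0)$. -}

module Defs where

open import Data.Nat using (ℕ; zero; suc; _+_; _*_; _⊔_; _<_)
open import Data.Bool using (Bool; true; false)
import Data.Bool.Properties as BoolP
open import Data.Fin using (Fin; _↑ˡ_; _↑ʳ_; combine)
open import Data.Fin.Subset using (Subset; _⊆_; _∈_; _∉_; _∪_; ⁅_⁆; ∣_∣; ⊥)
open import Data.Fin.Subset.Properties using (_⊆?_; _∈?_)
open import Data.Fin.Properties using (all?)
open import Data.List using (List; []; _∷_; map; _++_; filter; foldr)
open import Data.Vec using (Vec; []; _∷_; tabulate; lookup)
open import Data.Vec.Properties using (≡-dec)
open import Data.Product using (Σ; _×_; _,_; ∃)
open import Relation.Nullary using (Dec; ¬_)
open import Relation.Nullary.Decidable using (_×-dec_; _→-dec_; ¬?)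
open import Relation.Unary using (Pred; Decidable)
open import Relation.Binary.PropositionalEquality using (_≡_)
open import Level using (0ℓ)

record SetSystem : Set₁ where
  field
    size      : ℕ
    Feasible  : Pred (Subset size) 0ℓ
    feasible? : Decidable Feasible
open SetSystem public

record IsGreedoid (Γ : SetSystem) : Set where
  field
    empty-feasible : Feasible Γ ⊥
    augmentation   : ∀ (F F′ : Subset (size Γ)) → Feasible Γ F → Feasible Γ F′ →
                     ∣ F′ ∣ < ∣ F ∣ →
                     ∃ λ x → x ∈ F × x ∉ F′ × Feasible Γ (F′ ∪ ⁅ x ⁆)

allSubsets : ∀ n → List (Subset n)
allSubsets zero    = [] ∷ []
allSubsets (suc n) = map (true ∷_) (allSubsets n) ++ map (false ∷_) (allSubsets n)

maximum : List ℕ → ℕ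
maximum = foldr _⊔_ 0

rank : (Γ : SetSystem) → Subset (size Γ) → ℕ
rank Γ A = maximum (map ∣_∣ (filter (λ B → (B ⊆? A) ×-dec feasible? Γ B) (allSubsets (size Γ))))

rankΓ : SetSystem → ℕ
rankΓ Γ = rank Γ (tabulate (λ _ → true))

InClosure : (Γ : SetSystem) → Fin (size Γ) → Subset (size Γ) → Set
InClosure Γ e A = rank Γ (A ∪ ⁅ e ⁆) ≡ rank Γ A

SubClosure : (Γ : SetSystem) → Subset (size Γ) → Subset (size Γ) → Set
SubClosure Γ A B = ∀ e → e ∈ A → InClosure Γ e B

-- Γ-attachment function f : F → 2^[ρ(Γ)].  (Represented as a total
-- function on subsets; only its values on feasible sets are constrained.)
record AttachmentFunction (Γ : SetSystem) : Set where
  field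
    fun      : Subset (size Γ) → Subset (rankΓ Γ)
    card     : ∀ F → Feasible Γ F → ∣ fun F ∣ ≡ rank Γ F
    monotone : ∀ F₁ F₂ → Feasible Γ F₁ → Feasible Γ F₂ →
               SubClosure Γ F₁ F₂ → fun F₁ ⊆ fun F₂
open AttachmentFunction public

-- Ground set of Γ₁ ~_f Γ₂ : Fin (n₁ + ρ * n₂) = E₀ ⊎ (copies E₁ … E_ρ).
-- Element e of the i-th copy is  n₁ ↑ʳ combine i e.
module _ (Γ₁ Γ₂ : SetSystem) where
  private
    n₁ = size Γ₁
    n₂ = size Γ₂
    ρ  = rankΓ Γ₁

  attachSize : ℕ
  attachSize = n₁ + ρ * n₂

  part₀ : Subset attachSize → Subset n₁
  part₀ F = tabulate (λ e → lookup F (e ↑ˡ (ρ * n₂)))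

  partᵢ : Fin ρ → Subset attachSize → Subset n₂
  partᵢ i F = tabulate (λ e → lookup F (n₁ ↑ʳ combine i e))

  AttachFeasible : AttachmentFunction Γ₁ → Subset attachSize → Set
  AttachFeasible f F =
    Feasible Γ₁ (part₀ F) ×
    (∀ i → Feasible Γ₂ (partᵢ i F)) ×
    (∀ i → i ∉ fun f (part₀ F) → partᵢ i F ≡ ⊥)

  attachFeasible? : (f : AttachmentFunction Γ₁) → Decidable (AttachFeasible f)
  attachFeasible? f F =
    feasible? Γ₁ (part₀ F) ×-dec
    (all? (λ i → feasible? Γ₂ (partᵢ i F)) ×-dec
     all? (λ i → ¬? (i ∈? fun f (part₀ F)) →-dec ≡-dec BoolP._≟_ (partᵢ i F) ⊥))

attach : (Γ₁ Γ₂ : SetSystem) → AttachmentFunction Γ₁ → SetSystem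
attach Γ₁ Γ₂ f = record
  { size      = attachSize Γ₁ Γ₂
  ; Feasible  = AttachFeasible Γ₁ Γ₂ f
  ; feasible? = attachFeasible? Γ₁ Γ₂ f
  }

-- Let F, F′ be feasible in Γ₁ ∼_f Γ₂ with |F′| < |F|, and A = F ∩ E₀, A′ = F′ ∩ E₀.
-- If some x ∈ A augments A′ in Γ₁, add it: A′ ⊆ σ(A′ ∪ {x}), so f(A′) ⊆ f(A′ ∪ {x}) and every
-- copy allowed before stays allowed. Otherwise no element of A augments A′, which in a greedoid
-- forces A ⊆ σ(A′) (hence f(A) ⊆ f(A′)) and |A| ≤ |A′|. Then some copy E_i meets F in more
-- elements than F′; as F ∩ E_i ≠ ∅, feasibility of F gives i ∈ f(A) ⊆ f(A′), and augmenting
-- F′ ∩ E_i from F ∩ E_i in Γ₂ gives the required element.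

module Submission where

open import Defs
open import Data.Nat using (ℕ; zero; suc; _+_; _*_; _≤_; _<_; z≤n; s≤s; _<?_)
open import Data.Nat.Properties using (≤-trans; ≤-reflexive; ≤-antisym; m≤m⊔n; m≤n⊔m; ⊔-lub; +-mono-≤; ≮⇒≥; <⇒≱; module ≤-Reasoning)
open import Data.Bool using (true; false)
open import Data.Fin using (Fin; zero; suc; _↑ˡ_; _↑ʳ_; combine)
open import Data.Fin.Properties using (suc-injective; ↑ˡ-injective; ↑ʳ-injective; combine-injective; any?; _≟_)
open import Data.Fin.Subset using (Subset; _⊆_; _∈_; _∉_; _∪_; ⁅_⁆; ∣_∣; ⊥)
open import Data.Fin.Subset.Properties using (_∈?_; _⊆?_; ⊆-antisym; x∈p∪q⁻; x∈p∪q⁺; x∈⁅x⁆; x∈⁅y⁆⇒x≡y; ∉⊥; p⊆p∪q; ∣⊥∣≡0)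
open import Data.List using ([]; _∷_; map; filter)
open import Data.List.Membership.Propositional using () renaming (_∈_ to _∈ₗ_)
open import Data.List.Membership.Propositional.Properties using (∈-map⁺; ∈-map⁻; ∈-++⁺ˡ; ∈-++⁺ʳ; ∈-filter⁺; ∈-filter⁻)
open import Data.List.Relation.Unary.Any using (here; there)
open import Data.Vec using (tabulate; lookup; []; _∷_)
open import Data.Vec.Properties using ([]=⇒lookup; lookup⇒[]=; lookup∘tabulate; tabulate∘lookup; tabulate-cong)
open import Data.Product using (_×_; _,_; ∃; proj₁; proj₂)
open import Data.Sum using (_⊎_; inj₁; inj₂)
open import Data.Empty using (⊥-elim)
open import Function using (_∘_)
open import Function.Definitions using (Injective)
open import Relation.Nullary using (yes; no; ¬_)
open import Relation.Nullary.Decidable using (_×-dec_; ¬?)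
open import Relation.Unary using (Decidable)
open import Relation.Binary.PropositionalEquality using (_≡_; _≢_; refl; sym; trans; cong; subst; subst₂)

x∈p∪⁅y⁆⁻ : ∀ {n} (p : Subset n) {x y} → x ∈ p ∪ ⁅ y ⁆ → x ∈ p ⊎ x ≡ y
x∈p∪⁅y⁆⁻ p {y = y} x∈ with x∈p∪q⁻ p ⁅ y ⁆ x∈
... | inj₁ x∈p = inj₁ x∈p
... | inj₂ x∈y = inj₂ (x∈⁅y⁆⇒x≡y y x∈y)

x∈p∪⁅y⁆⁺ : ∀ {n} (p : Subset n) {x y} → x ∈ p ⊎ x ≡ y → x ∈ p ∪ ⁅ y ⁆
x∈p∪⁅y⁆⁺ p (inj₁ x∈p) = x∈p∪q⁺ (inj₁ x∈p)
x∈p∪⁅y⁆⁺ p {x} (inj₂ refl) = x∈p∪q⁺ {p = p} (inj₂ (x∈⁅x⁆ x))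

x∈p⇒p∪⁅x⁆≡p : ∀ {n} (p : Subset n) {x} → x ∈ p → p ∪ ⁅ x ⁆ ≡ p
x∈p⇒p∪⁅x⁆≡p p {x} x∈p = ⊆-antisym (absorb ∘ x∈p∪⁅y⁆⁻ p) (p⊆p∪q _)
  where
  absorb : ∀ {z} → z ∈ p ⊎ z ≡ x → z ∈ p
  absorb (inj₁ z∈p) = z∈p
  absorb (inj₂ refl) = x∈p

↑ˡ≢↑ʳ : ∀ {m} n (i : Fin m) (j : Fin n) → i ↑ˡ n ≢ m ↑ʳ j
↑ˡ≢↑ʳ n zero j ()
↑ˡ≢↑ʳ n (suc i) j eq = ↑ˡ≢↑ʳ n i j (suc-injective eq)

preimage : ∀ {m n} → (Fin m → Fin n) → Subset n → Subset m
preimage g p = tabulate (λ x → lookup p (g x))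

module _ {m n} (g : Fin m → Fin n) where

  ∈-preimage⁻ : ∀ {p x} → x ∈ preimage g p → g x ∈ p
  ∈-preimage⁻ {p} {x} x∈ = lookup⇒[]= (g x) p (trans (sym (lookup∘tabulate _ x)) ([]=⇒lookup x∈))

  ∈-preimage⁺ : ∀ {p x} → g x ∈ p → x ∈ preimage g p
  ∈-preimage⁺ {p} {x} gx∈ = lookup⇒[]= x _ (trans (lookup∘tabulate _ x) ([]=⇒lookup gx∈))

  preimage-⊥ : preimage g ⊥ ≡ ⊥
  preimage-⊥ = ⊆-antisym (λ x∈ → ⊥-elim (∉⊥ (∈-preimage⁻ x∈))) (λ x∈ → ⊥-elim (∉⊥ x∈))

  preimage-∪⁅image⁆ : Injective _≡_ _≡_ g → ∀ p x → preimage g (p ∪ ⁅ g x ⁆) ≡ preimage g p ∪ ⁅ x ⁆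
  preimage-∪⁅image⁆ g-inj p x = ⊆-antisym forward backward
    where
    forward : preimage g (p ∪ ⁅ g x ⁆) ⊆ preimage g p ∪ ⁅ x ⁆
    forward z∈ with x∈p∪⁅y⁆⁻ p (∈-preimage⁻ z∈)
    ... | inj₁ gz∈p = x∈p∪⁅y⁆⁺ _ (inj₁ (∈-preimage⁺ gz∈p))
    ... | inj₂ gz≡gx = x∈p∪⁅y⁆⁺ _ (inj₂ (g-inj gz≡gx))
    backward : preimage g p ∪ ⁅ x ⁆ ⊆ preimage g (p ∪ ⁅ g x ⁆)
    backward z∈ with x∈p∪⁅y⁆⁻ _ z∈
    ... | inj₁ z∈p = ∈-preimage⁺ (x∈p∪⁅y⁆⁺ p (inj₁ (∈-preimage⁻ z∈p)))
    ... | inj₂ refl = ∈-preimage⁺ (x∈p∪⁅y⁆⁺ p (inj₂ refl))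

  preimage-∪⁅non-image⁆ : ∀ p {y} → (∀ x → g x ≢ y) → preimage g (p ∪ ⁅ y ⁆) ≡ preimage g p
  preimage-∪⁅non-image⁆ p {y} y∉img = ⊆-antisym forward (λ z∈ → ∈-preimage⁺ (p⊆p∪q {p = p} ⁅ y ⁆ (∈-preimage⁻ z∈)))
    where
    forward : preimage g (p ∪ ⁅ y ⁆) ⊆ preimage g p
    forward {z} z∈ with x∈p∪⁅y⁆⁻ p (∈-preimage⁻ z∈)
    ... | inj₁ gz∈p = ∈-preimage⁺ gz∈p
    ... | inj₂ gz≡y = ⊥-elim (y∉img z gz≡y)

preimage-∘ : ∀ {l m n} (g : Fin m → Fin n) (h : Fin l → Fin m) p →
             preimage h (preimage g p) ≡ preimage (g ∘ h) p
preimage-∘ g h p = tabulate-cong (λ x → lookup∘tabulate _ (h x))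

∣p∣≡∣preimage-↑ˡ∣+∣preimage-↑ʳ∣ : ∀ m {k} (p : Subset (m + k)) →
                                  ∣ p ∣ ≡ ∣ preimage (_↑ˡ k) p ∣ + ∣ preimage (m ↑ʳ_) p ∣
∣p∣≡∣preimage-↑ˡ∣+∣preimage-↑ʳ∣ zero p = cong ∣_∣ (sym (tabulate∘lookup p))
∣p∣≡∣preimage-↑ˡ∣+∣preimage-↑ʳ∣ (suc m) (false ∷ p) = ∣p∣≡∣preimage-↑ˡ∣+∣preimage-↑ʳ∣ m p
∣p∣≡∣preimage-↑ˡ∣+∣preimage-↑ʳ∣ (suc m) (true ∷ p) = cong suc (∣p∣≡∣preimage-↑ˡ∣+∣preimage-↑ʳ∣ m p)

∣∣-mono-blockwise : ∀ k {n} (p q : Subset (k * n)) →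
                    (∀ (i : Fin k) → ∣ preimage (combine {n = n} i) p ∣ ≤ ∣ preimage (combine i) q ∣) →
                    ∣ p ∣ ≤ ∣ q ∣
∣∣-mono-blockwise zero [] [] _ = z≤n
∣∣-mono-blockwise (suc k) {n} p q blocks≤ = begin
  ∣ p ∣                                                          ≡⟨ ∣p∣≡∣preimage-↑ˡ∣+∣preimage-↑ʳ∣ n p ⟩
  ∣ preimage (_↑ˡ (k * n)) p ∣ + ∣ preimage (n ↑ʳ_) p ∣          ≤⟨ +-mono-≤ (blocks≤ zero) (∣∣-mono-blockwise k (preimage (n ↑ʳ_) p) (preimage (n ↑ʳ_) q) tail≤) ⟩
  ∣ preimage (_↑ˡ (k * n)) q ∣ + ∣ preimage (n ↑ʳ_) q ∣          ≡⟨ sym (∣p∣≡∣preimage-↑ˡ∣+∣preimage-↑ʳ∣ n q) ⟩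
  ∣ q ∣                                                          ∎
  where
  open ≤-Reasoning
  tail≤ : ∀ i → ∣ preimage (combine {n = n} i) (preimage (n ↑ʳ_) p) ∣ ≤ ∣ preimage (combine i) (preimage (n ↑ʳ_) q) ∣
  tail≤ i = subst₂ _≤_ (cong ∣_∣ (sym (preimage-∘ (n ↑ʳ_) (combine i) p)))
                       (cong ∣_∣ (sym (preimage-∘ (n ↑ʳ_) (combine i) q)))
                       (blocks≤ (suc i))

∈-allSubsets : ∀ n (p : Subset n) → p ∈ₗ allSubsets n
∈-allSubsets zero [] = here refl
∈-allSubsets (suc n) (true ∷ p) = ∈-++⁺ˡ (∈-map⁺ (true ∷_) (∈-allSubsets n p))
∈-allSubsets (suc n) (false ∷ p) = ∈-++⁺ʳ (map (true ∷_) (allSubsets n)) (∈-map⁺ (false ∷_) (∈-allSubsets n p))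

∈⇒≤maximum : ∀ {x} xs → x ∈ₗ xs → x ≤ maximum xs
∈⇒≤maximum (y ∷ ys) (here refl) = m≤m⊔n y (maximum ys)
∈⇒≤maximum (y ∷ ys) (there x∈) = ≤-trans (∈⇒≤maximum ys x∈) (m≤n⊔m y (maximum ys))

maximum≤ : ∀ {k} xs → (∀ {x} → x ∈ₗ xs → x ≤ k) → maximum xs ≤ k
maximum≤ [] _ = z≤n
maximum≤ (y ∷ ys) all≤ = ⊔-lub (all≤ (here refl)) (maximum≤ ys (all≤ ∘ there))

module _ (Γ : SetSystem) where

  private
    feasibleIn? : (A : Subset (size Γ)) → Decidable (λ B → B ⊆ A × Feasible Γ B)
    feasibleIn? A B = (B ⊆? A) ×-dec feasible? Γ B

  ∣∣≤rank : ∀ {A B} → B ⊆ A → Feasible Γ B → ∣ B ∣ ≤ rank Γ A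
  ∣∣≤rank {A} {B} B⊆A feasB =
    ∈⇒≤maximum _ (∈-map⁺ ∣_∣ (∈-filter⁺ (feasibleIn? A) (∈-allSubsets _ B) (B⊆A , feasB)))

  rank≤ : ∀ {A k} → (∀ B → B ⊆ A → Feasible Γ B → ∣ B ∣ ≤ k) → rank Γ A ≤ k
  rank≤ {A} {k} bound = maximum≤ _ λ x∈ → bounded (∈-map⁻ ∣_∣ x∈)
    where
    bounded : ∀ {x} → ∃ (λ B → B ∈ₗ filter (feasibleIn? A) (allSubsets (size Γ)) × x ≡ ∣ B ∣) → x ≤ k
    bounded (B , B∈ , refl) with ∈-filter⁻ (feasibleIn? A) {xs = allSubsets (size Γ)} B∈
    ... | _ , B⊆A , feasB = bound B B⊆A feasB

  rank-mono : ∀ {A B} → A ⊆ B → rank Γ A ≤ rank Γ B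
  rank-mono A⊆B = rank≤ (λ C C⊆A feasC → ∣∣≤rank (A⊆B ∘ C⊆A) feasC)

  ⊆⇒SubClosure : ∀ {A B} → A ⊆ B → SubClosure Γ A B
  ⊆⇒SubClosure {B = B} A⊆B e e∈A = cong (rank Γ) (x∈p⇒p∪⁅x⁆≡p B (A⊆B e∈A))

Augmentable : (Γ : SetSystem) → Subset (size Γ) → Subset (size Γ) → Set
Augmentable Γ A A′ = ∃ λ x → x ∈ A × x ∉ A′ × Feasible Γ (A′ ∪ ⁅ x ⁆)

module _ {Γ : SetSystem} (greedoid : IsGreedoid Γ) where

  open IsGreedoid greedoid

  nonAugmentable⇒∣∣≤ : ∀ {A A′} → Feasible Γ A → Feasible Γ A′ → ¬ Augmentable Γ A A′ → ∣ A ∣ ≤ ∣ A′ ∣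
  nonAugmentable⇒∣∣≤ {A} {A′} feasA feasA′ nonAug = ≮⇒≥ (nonAug ∘ augmentation A A′ feasA feasA′)

  -- No feasible B ⊆ A′ ∪ {e} augments A′ either, so |B| ≤ |A′|: adding e cannot raise the rank.
  nonAugmentable⇒SubClosure : ∀ {A A′} → Feasible Γ A′ → ¬ Augmentable Γ A A′ → SubClosure Γ A A′
  nonAugmentable⇒SubClosure {A} {A′} feasA′ nonAug e e∈A with e ∈? A′
  ... | yes e∈A′ = ⊆⇒SubClosure Γ (λ x∈ → x∈) e e∈A′
  ... | no e∉A′ = ≤-antisym (≤-trans (rank≤ Γ bound) (∣∣≤rank Γ (λ x∈ → x∈) feasA′)) (rank-mono Γ (p⊆p∪q _))
    where
    bound : ∀ B → B ⊆ A′ ∪ ⁅ e ⁆ → Feasible Γ B → ∣ B ∣ ≤ ∣ A′ ∣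
    bound B B⊆ feasB = nonAugmentable⇒∣∣≤ feasB feasA′ nonAugB
      where
      nonAugB : ¬ Augmentable Γ B A′
      nonAugB (y , y∈B , y∉A′ , feas) with x∈p∪⁅y⁆⁻ A′ (B⊆ y∈B)
      ... | inj₁ y∈A′ = y∉A′ y∈A′
      ... | inj₂ refl = nonAug (y , e∈A , e∉A′ , feas)

-- part₀ F and partᵢ i F are, definitionally, preimage ι₀ F and preimage (ι i) F.
module Attachment (Γ₁ Γ₂ : SetSystem) (f : AttachmentFunction Γ₁) where

  private
    n₁ n₂ ρ : ℕ
    n₁ = size Γ₁
    n₂ = size Γ₂
    ρ  = rankΓ Γ₁

    Feasible∼ : Subset (attachSize Γ₁ Γ₂) → Set
    Feasible∼ = AttachFeasible Γ₁ Γ₂ f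

    A₀ : Subset (attachSize Γ₁ Γ₂) → Subset n₁
    A₀ = part₀ Γ₁ Γ₂

    Aᵢ : Fin ρ → Subset (attachSize Γ₁ Γ₂) → Subset n₂
    Aᵢ = partᵢ Γ₁ Γ₂

  ι₀ : Fin n₁ → Fin (attachSize Γ₁ Γ₂)
  ι₀ x = x ↑ˡ (ρ * n₂)

  ι : Fin ρ → Fin n₂ → Fin (attachSize Γ₁ Γ₂)
  ι i y = n₁ ↑ʳ combine i y

  ι₀≢ι : ∀ x i y → ι₀ x ≢ ι i y
  ι₀≢ι x i y = ↑ˡ≢↑ʳ (ρ * n₂) x (combine i y)

  ι-injective : ∀ {i j y z} → ι i y ≡ ι j z → i ≡ j × y ≡ z
  ι-injective {i} {j} {y} {z} eq = combine-injective i y j z (↑ʳ-injective n₁ _ _ eq)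

  ∣∣≤-by-parts : ∀ F F′ → ∣ A₀ F ∣ ≤ ∣ A₀ F′ ∣ → (∀ i → ∣ Aᵢ i F ∣ ≤ ∣ Aᵢ i F′ ∣) → ∣ F ∣ ≤ ∣ F′ ∣
  ∣∣≤-by-parts F F′ A₀≤ Aᵢ≤ = begin
    ∣ F ∣                        ≡⟨ ∣p∣≡∣preimage-↑ˡ∣+∣preimage-↑ʳ∣ n₁ F ⟩
    ∣ A₀ F ∣ + ∣ copies F ∣      ≤⟨ +-mono-≤ A₀≤ (∣∣-mono-blockwise ρ (copies F) (copies F′) copies≤) ⟩
    ∣ A₀ F′ ∣ + ∣ copies F′ ∣    ≡⟨ sym (∣p∣≡∣preimage-↑ˡ∣+∣preimage-↑ʳ∣ n₁ F′) ⟩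
    ∣ F′ ∣                       ∎
    where
    open ≤-Reasoning
    copies : Subset (attachSize Γ₁ Γ₂) → Subset (ρ * n₂)
    copies = preimage (n₁ ↑ʳ_)
    copies≤ : ∀ i → ∣ preimage (combine {n = n₂} i) (copies F) ∣ ≤ ∣ preimage (combine i) (copies F′) ∣
    copies≤ i = subst₂ _≤_ (cong ∣_∣ (sym (preimage-∘ (n₁ ↑ʳ_) (combine i) F)))
                           (cong ∣_∣ (sym (preimage-∘ (n₁ ↑ʳ_) (combine i) F′)))
                           (Aᵢ≤ i)

  feasible∼-⊥ : IsGreedoid Γ₁ → IsGreedoid Γ₂ → Feasible∼ ⊥
  feasible∼-⊥ greedoid₁ greedoid₂ =
      subst (Feasible Γ₁) (sym (preimage-⊥ ι₀)) (IsGreedoid.empty-feasible greedoid₁)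
    , (λ i → subst (Feasible Γ₂) (sym (preimage-⊥ (ι i))) (IsGreedoid.empty-feasible greedoid₂))
    , (λ i _ → preimage-⊥ (ι i))

  feasible∼-∪ι₀ : ∀ {F x} → Feasible∼ F → Feasible Γ₁ (A₀ F ∪ ⁅ x ⁆) → Feasible∼ (F ∪ ⁅ ι₀ x ⁆)
  feasible∼-∪ι₀ {F} {x} (feas₀ , feasᵢ , empty) feas₀′ =
      subst (Feasible Γ₁) (sym A₀≡) feas₀′
    , (λ i → subst (Feasible Γ₂) (sym (Aᵢ≡ i)) (feasᵢ i))
    , (λ i i∉ → trans (Aᵢ≡ i) (empty i (i∉ ∘ subst (λ A → i ∈ fun f A) (sym A₀≡) ∘ f-grows)))
    where
    A₀≡ : A₀ (F ∪ ⁅ ι₀ x ⁆) ≡ A₀ F ∪ ⁅ x ⁆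
    A₀≡ = preimage-∪⁅image⁆ ι₀ (↑ˡ-injective (ρ * n₂) _ _) F x
    Aᵢ≡ : ∀ i → Aᵢ i (F ∪ ⁅ ι₀ x ⁆) ≡ Aᵢ i F
    Aᵢ≡ i = preimage-∪⁅non-image⁆ (ι i) F (λ y eq → ι₀≢ι x i y (sym eq))
    f-grows : fun f (A₀ F) ⊆ fun f (A₀ F ∪ ⁅ x ⁆)
    f-grows = monotone f _ _ feas₀ feas₀′ (⊆⇒SubClosure Γ₁ (p⊆p∪q _))

  feasible∼-∪ι : ∀ {F i y} → Feasible∼ F → i ∈ fun f (A₀ F) → Feasible Γ₂ (Aᵢ i F ∪ ⁅ y ⁆) →
                 Feasible∼ (F ∪ ⁅ ι i y ⁆)
  feasible∼-∪ι {F} {i} {y} (feas₀ , feasᵢ , empty) i∈f feasᵢ′ =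
      subst (Feasible Γ₁) (sym A₀≡) feas₀
    , feasⱼ
    , emptyⱼ
    where
    A₀≡ : A₀ (F ∪ ⁅ ι i y ⁆) ≡ A₀ F
    A₀≡ = preimage-∪⁅non-image⁆ ι₀ F (λ x → ι₀≢ι x i y)
    Aⱼ≡ : ∀ {j} → j ≢ i → Aᵢ j (F ∪ ⁅ ι i y ⁆) ≡ Aᵢ j F
    Aⱼ≡ j≢i = preimage-∪⁅non-image⁆ (ι _) F (λ z → j≢i ∘ proj₁ ∘ ι-injective)
    feasⱼ : ∀ j → Feasible Γ₂ (Aᵢ j (F ∪ ⁅ ι i y ⁆))
    feasⱼ j with j ≟ i
    ... | yes refl = subst (Feasible Γ₂) (sym (preimage-∪⁅image⁆ (ι i) (proj₂ ∘ ι-injective) F y)) feasᵢ′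
    ... | no j≢i = subst (Feasible Γ₂) (sym (Aⱼ≡ j≢i)) (feasᵢ j)
    emptyⱼ : ∀ j → j ∉ fun f (A₀ (F ∪ ⁅ ι i y ⁆)) → Aᵢ j (F ∪ ⁅ ι i y ⁆) ≡ ⊥
    emptyⱼ j j∉ rewrite A₀≡ with j ≟ i
    ... | yes refl = ⊥-elim (j∉ i∈f)
    ... | no j≢i = trans (Aⱼ≡ j≢i) (empty j j∉)

  occupied⇒∈fun : ∀ {F i} → Feasible∼ F → 0 < ∣ Aᵢ i F ∣ → i ∈ fun f (A₀ F)
  occupied⇒∈fun {F} {i} (_ , _ , empty) 0<∣Aᵢ∣ with i ∈? fun f (A₀ F)
  ... | yes i∈f = i∈f
  ... | no i∉f = ⊥-elim (<⇒≱ 0<∣Aᵢ∣ (≤-reflexive (trans (cong ∣_∣ (empty i i∉f)) (∣⊥∣≡0 n₂))))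

  module _ (greedoid₁ : IsGreedoid Γ₁) (greedoid₂ : IsGreedoid Γ₂) where

    augmentation∼-in-copy : ∀ {F F′} → Feasible∼ F → Feasible∼ F′ → ∣ F′ ∣ < ∣ F ∣ →
                            ¬ Augmentable Γ₁ (A₀ F) (A₀ F′) → Augmentable (attach Γ₁ Γ₂ f) F F′
    augmentation∼-in-copy {F} {F′} feasF@(feas₀ , feasᵢ , _) feasF′@(feas₀′ , feasᵢ′ , _) F′<F nonAug
      with any? (λ i → ∣ Aᵢ i F′ ∣ <? ∣ Aᵢ i F ∣)
    ... | no ¬lt = ⊥-elim (<⇒≱ F′<F (∣∣≤-by-parts F F′ A₀≤ (λ i → ≮⇒≥ (¬lt ∘ (i ,_)))))
      where
      A₀≤ : ∣ A₀ F ∣ ≤ ∣ A₀ F′ ∣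
      A₀≤ = nonAugmentable⇒∣∣≤ greedoid₁ feas₀ feas₀′ nonAug
    ... | yes (i , Aᵢ<) with IsGreedoid.augmentation greedoid₂ _ _ (feasᵢ i) (feasᵢ′ i) Aᵢ<
    ...   | y , y∈ , y∉ , feas =
      ι i y , ∈-preimage⁻ (ι i) y∈ , y∉ ∘ ∈-preimage⁺ (ι i) , feasible∼-∪ι {F′} feasF′ (f-mono i∈f) feas
      where
      f-mono : fun f (A₀ F) ⊆ fun f (A₀ F′)
      f-mono = monotone f _ _ feas₀ feas₀′ (nonAugmentable⇒SubClosure greedoid₁ feas₀′ nonAug)
      i∈f : i ∈ fun f (A₀ F)
      i∈f = occupied⇒∈fun {F} feasF (≤-trans (s≤s z≤n) Aᵢ<)

    augmentation∼ : ∀ F F′ → Feasible∼ F → Feasible∼ F′ → ∣ F′ ∣ < ∣ F ∣ → Augmentable (attach Γ₁ Γ₂ f) F F′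
    augmentation∼ F F′ feasF feasF′ F′<F
      with any? (λ x → x ∈? A₀ F ×-dec ¬? (x ∈? A₀ F′) ×-dec feasible? Γ₁ (A₀ F′ ∪ ⁅ x ⁆))
    ... | yes (x , x∈ , x∉ , feas) = ι₀ x , ∈-preimage⁻ ι₀ x∈ , x∉ ∘ ∈-preimage⁺ ι₀ , feasible∼-∪ι₀ {F′} feasF′ feas
    ... | no ¬aug = augmentation∼-in-copy feasF feasF′ F′<F ¬aug

proposition4p3 : (Γ₁ Γ₂ : SetSystem) → IsGreedoid Γ₁ → IsGreedoid Γ₂ →
                 (f : AttachmentFunction Γ₁) → IsGreedoid (attach Γ₁ Γ₂ f)
proposition4p3 Γ₁ Γ₂ greedoid₁ greedoid₂ f = record
  { empty-feasible = feasible∼-⊥ greedoid₁ greedoid₂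
  ; augmentation   = augmentation∼ greedoid₁ greedoid₂
  }
  where open Attachment Γ₁ Γ₂ f
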